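{- Let $A=(a_{i,j})$ be an $n\times n$ matrix with nonzero determinant, let $X=\operatorname{diag}(x_1,\dots,x_n)$ be a diagonal matrix of formal variables $x_1,\dots,x_n$, and let $(\varphi_1,\dots,\varphi_n)$ be a vector of normally distributed random variables with mean $0$ in every component and covariance matrix $XA$. Then $$\operatorname{perm}(A)=\text{the coefficient of the } x_1x_2\cdots x_n \text{ term in } \Big\langle \prod_{i=1}^n 2\cosh\varphi_i\Big\rangle_{\varphi\sim\mathcal{N}(0,XA)},$$ where $\langle\cdot\rangle_{\varphi\sim\mathcal{N}(0,XA)}$ denotes the expectation over $(\varphi_1,\dots,\varphi_n)$ normally distributed with mean $0$ and covariance matrix $XA$.
   Context: The permanent of an $n\times n$ matrix $A=(a_{i,j})$ is $\operatorname{perm}(A)=\sum_{\sigma\in S_n}\prod_{i=1}^n a_{i,\sigma(i)}$, where $S_n$ is the symmetric group. The Gaussian expectation is understood via the standard multivariate Gaussian formula, so that $\langle\prod_i 2\cosh\varphi_i\rangle_{\mathcal{N}(0,W)}=\sum_{s\in\{\pm1\}^n}\exp\big(\tfrac12\sum_{i,j}s_iW_{i,j}s_j\big)$ with $W=XA$, viewed as a formal power series in $x_1,\dots,x_n$. -}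

module Defs where

open import Level using (Level; _⊔_) renaming (suc to lsuc)
open import Algebra.Bundles using (CommutativeRing)
open import Data.Nat as ℕ using (ℕ; zero; suc)

open import Data.Bool using (Bool; true; false; if_then_else_; _∧_; not)
open import Data.Fin as Fin using (Fin)
open import Data.Vec as Vec using (Vec; []; _∷_; lookup; replicate)
open import Data.List as List using (List; []; _∷_; map; concatMap; foldr; filter; upTo; allFin)
open import Relation.Nullary using (¬_)
open import Relation.Nullary.Decidable using (⌊_⌋)
import Data.Vec.Properties as VecP
import Data.Nat.Properties as NatP
import Data.Nat.ListAction as NLA

embedℕ : ∀ {c ℓ} (R : CommutativeRing c ℓ) → ℕ → CommutativeRing.Carrier R
embedℕ R zero    = CommutativeRing.0# R
embedℕ R (suc k) = CommutativeRing._+_ R (CommutativeRing.1# R) (embedℕ R k)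

record CharZeroField (c ℓ : Level) : Set (lsuc (c ⊔ ℓ)) where
  field
    commRing : CommutativeRing c ℓ
  open CommutativeRing commRing
  field
    inv      : (x : Carrier) → ¬ (x ≈ 0#) → Carrier
    inverse  : (x : Carrier) (p : ¬ (x ≈ 0#)) → (x * inv x p) ≈ 1#
    charZero : (k : ℕ) → ¬ (embedℕ commRing (suc k) ≈ 0#)

module Field {c ℓ} (F : CharZeroField c ℓ) where
  open CharZeroField F public
  open CommutativeRing commRing public

  Σ : List Carrier → Carrier
  Σ = foldr _+_ 0#

  Π : List Carrier → Carrier
  Π = foldr _*_ 1#

  Matrix : ℕ → Set c
  Matrix n = Fin n → Fin n → Carrier

  -- The symmetric group S_n: the bijections of Fin n, each represented
  -- by its table of values (σ 0, …, σ (n-1)), listed exhaustively.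

  allVecs : (n k : ℕ) → List (Vec (Fin n) k)
  allVecs n zero    = [] ∷ []
  allVecs n (suc k) = concatMap (λ i → map (i ∷_) (allVecs n k)) (allFin n)

  notIn : ∀ {n} → Fin n → List (Fin n) → Bool
  notIn i []       = true
  notIn i (j ∷ js) = not ⌊ i Fin.≟ j ⌋ ∧ notIn i js

  distinct : ∀ {n} → List (Fin n) → Bool
  distinct []       = true
  distinct (i ∷ is) = notIn i is ∧ distinct is

  -- a map Fin n → Fin n is a permutation iff it is injective
  Sym : (n : ℕ) → List (Vec (Fin n) n)
  Sym n = filter (λ σ → Data.Bool._≟_ (distinct (Vec.toList σ)) true) (allVecs n n)
    where import Data.Bool

  inversions : ∀ {n} → Vec (Fin n) n → ℕ
  inversions {n} σ =
    NLA.sum (map (λ i → List.length (filter (λ j → i Fin.<? j)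
                     (filter (λ j → lookup σ j Fin.<? lookup σ i) (allFin n)))) (allFin n))

  sgn : ℕ → Carrier
  sgn zero    = 1#
  sgn (suc k) = - (sgn k)

  perm : ∀ {n} → Matrix n → Carrier
  perm {n} A = Σ (map (λ σ → Π (map (λ i → A i (lookup σ i)) (allFin n))) (Sym n))

  det : ∀ {n} → Matrix n → Carrier
  det {n} A = Σ (map (λ σ → sgn (inversions σ) * Π (map (λ i → A i (lookup σ i)) (allFin n))) (Sym n))

  -- Formal power series in the variables x_1, …, x_n over the field:
  -- a series is its coefficient function on monomials x^m (m ∈ ℕ^n).
  Monomial : ℕ → Set
  Monomial n = Vec ℕ n

  Series : ℕ → Set c
  Series n = Monomial n → Carrier

  below : ∀ {n} → Monomial n → List (Monomial n)
  below []      = [] ∷ []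
  below (k ∷ m) = concatMap (λ i → map (i ∷_) (below m)) (upTo (suc k))

  _∸ᵥ_ : ∀ {n} → Monomial n → Monomial n → Monomial n
  _∸ᵥ_ = Vec.zipWith ℕ._∸_

  degree : ∀ {n} → Monomial n → ℕ
  degree = Vec.sum

  zeroSeries : ∀ {n} → Series n
  zeroSeries m = 0#

  _==ₘ_ : ∀ {n} → Monomial n → Monomial n → Bool
  m ==ₘ m' = ⌊ VecP.≡-dec NatP._≟_ m m' ⌋

  oneSeries : ∀ {n} → Series n
  oneSeries m = if m ==ₘ replicate _ 0 then 1# else 0#

  var : ∀ {n} → Fin n → Series n
  var {n} i m = if m ==ₘ Vec.updateAt (replicate n 0) i (λ _ → 1) then 1# else 0#

  _·_ : ∀ {n} → Carrier → Series n → Series n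
  (c · f) m = c * f m

  _⊕_ : ∀ {n} → Series n → Series n → Series n
  (f ⊕ g) m = f m + g m

  Σₛ : ∀ {n} → List (Series n) → Series n
  Σₛ = foldr _⊕_ zeroSeries

  _⊗_ : ∀ {n} → Series n → Series n → Series n
  (f ⊗ g) m = Σ (map (λ a → f a * g (m ∸ᵥ a)) (below m))

  _^ₛ_ : ∀ {n} → Series n → ℕ → Series n
  f ^ₛ zero  = oneSeries
  f ^ₛ suc k = f ⊗ (f ^ₛ k)

  invSuc : ℕ → Carrier
  invSuc k = inv (embedℕ commRing (suc k)) (charZero k)

  invFact : ℕ → Carrier
  invFact zero    = 1#
  invFact (suc k) = invSuc k * invFact k

  half : Carrier
  half = invSuc 1

  -- formal exponential exp(f) = Σ_k f^k / k!, for a series f with zero constant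
  -- term: only the terms k ≤ deg(m) contribute to the coefficient of x^m
  expₛ : ∀ {n} → Series n → Series n
  expₛ f m = Σ (map (λ k → invFact k * (f ^ₛ k) m) (upTo (suc (degree m))))

  -- Gaussian expectation ⟨ Π_i 2 cosh φ_i ⟩ for φ ~ N(0, W), W = X A,
  -- X = diag(x_1,…,x_n), understood (as in the paper) as the formal series
  --   Σ_{s ∈ {±1}^n} exp( ½ Σ_{i,j} s_i W_{ij} s_j ).

  XA : ∀ {n} → Matrix n → Fin n → Fin n → Series n
  XA A i j = A i j · var i

  allSigns : (n : ℕ) → List (Vec Bool n)
  allSigns zero    = [] ∷ []
  allSigns (suc n) = concatMap (λ b → map (b ∷_) (allSigns n)) (true ∷ false ∷ [])

  spin : Bool → Carrier
  spin b = if b then 1# else - 1#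

  quadForm : ∀ {n} → (Fin n → Fin n → Series n) → Vec Bool n → Series n
  quadForm {n} W s =
    half · Σₛ (concatMap (λ i → map (λ j → (spin (lookup s i) * spin (lookup s j)) · W i j)
                                    (allFin n)) (allFin n))

  gaussianCoshExpectation : ∀ {n} → (Fin n → Fin n → Series n) → Series n
  gaussianCoshExpectation {n} W = Σₛ (map (λ s → expₛ (quadForm W s)) (allSigns n))

  coeffAllOnes : ∀ {n} → Series n → Carrier
  coeffAllOnes {n} f = f (replicate n 1)

-- For a sign vector s the exponent ½ Σᵢⱼ sᵢ xᵢ aᵢⱼ sⱼ is linear in the variables,
-- Σᵢ cᵢ(s) xᵢ with cᵢ(s) = ½ Σⱼ sᵢ sⱼ aᵢⱼ, and the coefficient of x₁ ⋯ xₙ in the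
-- exponential of a linear form is the product of its coefficients (by the product rule
-- for f^(k+1) in one variable at a time). Expanding Πᵢ cᵢ(s) over all maps σ : Fin n → Fin n
-- and summing over s first gives σ the weight Πⱼ ½ Σ_{sⱼ = ±1} sⱼ^(1 + |σ⁻¹ j|), which is 1
-- if every fibre of σ is a singleton and 0 if some fibre is empty. By pigeonhole these are
-- exactly the injective and the non-injective σ, so only the permutations survive, each
-- with weight 1, and the sum is perm A.

module Submission where

open import Defs
open import Algebra.Bundles using (CommutativeMonoid; CommutativeSemiring)
open import Data.Nat as ℕ using (ℕ; zero; suc; _≤_; _<_; z≤n; s≤s)
import Data.Nat.Properties as ℕP
open import Data.Nat.ListAction using (sum)
open import Data.Bool using (Bool; true; false; if_then_else_; _∧_)
import Data.Bool
open import Data.Fin as Fin using (Fin)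
open import Data.Vec as Vec using (Vec; []; _∷_; lookup; replicate; toList)
import Data.Vec.Properties as VecP
open import Data.List as List using (List; []; _∷_; map; concatMap; foldr; filter; upTo; allFin; _++_; applyUpTo; length)
import Data.List.Properties as ListP
open import Data.List.Relation.Unary.All as All using (All; []; _∷_)
open import Data.List.Relation.Unary.All.Properties using (¬Any⇒All¬)
open import Data.List.Relation.Unary.Any as Any using (Any; here; there)
open import Data.List.Membership.Propositional.Properties using (∈-allFin)
open import Data.Product using (∃; _,_; _×_)
open import Data.Empty using (⊥-elim)
open import Relation.Binary.PropositionalEquality as ≡ using (_≡_; _≢_)
open import Relation.Nullary using (does; yes; no; ¬_)
open import Relation.Nullary.Decidable using (isYes≗does)
open import Relation.Unary using (Pred; Decidable)
open import Function using (_∘_)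

allFin-suc : ∀ n → allFin (suc n) ≡ Fin.zero ∷ map Fin.suc (allFin n)
allFin-suc n = ≡.cong (Fin.zero ∷_) (≡.sym (ListP.map-tabulate (λ i → i) Fin.suc))

map-allFin-suc : ∀ {a} {A : Set a} {n} (h : Fin (suc n) → A) →
  map h (allFin (suc n)) ≡ h Fin.zero ∷ map (h ∘ Fin.suc) (allFin n)
map-allFin-suc {n = n} h =
  ≡.trans (≡.cong (map h) (allFin-suc n)) (≡.cong (h Fin.zero ∷_) (≡.sym (ListP.map-∘ (allFin n))))

map-lookup-allFin : ∀ {a} {A : Set a} {n k} (h : Fin n → A) (σ : Vec (Fin n) k) →
  map (h ∘ lookup σ) (allFin k) ≡ map h (toList σ)
map-lookup-allFin h []      = ≡.refl
map-lookup-allFin h (x ∷ σ) =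
  ≡.trans (map-allFin-suc (h ∘ lookup (x ∷ σ))) (≡.cong (h x ∷_) (map-lookup-allFin h σ))

map-applyUpTo : ∀ {a b} {A : Set a} {B : Set b} (h : A → B) (g : ℕ → A) k →
  map h (applyUpTo g k) ≡ applyUpTo (h ∘ g) k
map-applyUpTo h g zero    = ≡.refl
map-applyUpTo h g (suc k) = ≡.cong (h (g 0) ∷_) (map-applyUpTo h (g ∘ suc) k)

map-upTo-suc : ∀ {a} {A : Set a} (h : ℕ → A) k → map h (upTo (suc k)) ≡ h 0 ∷ map (h ∘ suc) (upTo k)
map-upTo-suc h k =
  ≡.cong (h 0 ∷_) (≡.trans (map-applyUpTo h suc k) (≡.sym (map-applyUpTo (h ∘ suc) (λ i → i) k)))

vecsOver : ∀ {b} {B : Set b} → List B → (k : ℕ) → List (Vec B k)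
vecsOver Bs zero    = [] ∷ []
vecsOver Bs (suc k) = concatMap (λ b → map (b ∷_) (vecsOver Bs k)) Bs

count : ∀ {n} → Fin n → List (Fin n) → ℕ
count j []       = 0
count j (x ∷ xs) = if does (j Fin.≟ x) then suc (count j xs) else count j xs

count-++ : ∀ {n} (j : Fin n) xs ys → count j (xs ++ ys) ≡ count j xs ℕ.+ count j ys
count-++ j []       ys = ≡.refl
count-++ j (x ∷ xs) ys with does (j Fin.≟ x)
... | true  = ≡.cong suc (count-++ j xs ys)
... | false = count-++ j xs ys

count-zero-map-suc : ∀ {n} (L : List (Fin n)) → count Fin.zero (map Fin.suc L) ≡ 0
count-zero-map-suc []      = ≡.refl
count-zero-map-suc (x ∷ L) = count-zero-map-suc L

count-suc-map-suc : ∀ {n} (j : Fin n) L → count (Fin.suc j) (map Fin.suc L) ≡ count j L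
count-suc-map-suc j []      = ≡.refl
count-suc-map-suc j (x ∷ L) =
  ≡.cong (λ k → if does (j Fin.≟ x) then suc k else k) (count-suc-map-suc j L)

count-allFin : ∀ {n} (j : Fin n) → count j (allFin n) ≡ 1
count-allFin {suc n} j = ≡.trans (≡.cong (count j) (allFin-suc n)) (count-zero∷map-suc j)
  where
  count-zero∷map-suc : ∀ j → count j (Fin.zero ∷ map Fin.suc (allFin n)) ≡ 1
  count-zero∷map-suc Fin.zero    = ≡.cong suc (count-zero-map-suc (allFin n))
  count-zero∷map-suc (Fin.suc j) = ≡.trans (count-suc-map-suc j (allFin n)) (count-allFin j)

count-self : ∀ {n} (x : Fin n) xs → count x (x ∷ xs) ≡ suc (count x xs)
count-self x xs with x Fin.≟ x
... | yes _  = ≡.refl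
... | no x≢x = ⊥-elim (x≢x ≡.refl)

count≤count-∷ : ∀ {n} (j x : Fin n) L → count j L ≤ count j (x ∷ L)
count≤count-∷ j x L with does (j Fin.≟ x)
... | true  = ℕP.n≤1+n _
... | false = ℕP.≤-refl

module BigOperator {c ℓ} (M : CommutativeMonoid c ℓ) where
  open CommutativeMonoid M
  open import Algebra.Properties.CommutativeSemigroup commutativeSemigroup using (interchange)
  open import Relation.Binary.Reasoning.Setoid setoid

  ⨁ : List Carrier → Carrier
  ⨁ = foldr _∙_ ε

  module _ {a} {A : Set a} where

    map-cong : ∀ {f g : A → Carrier} L → (∀ x → f x ≈ g x) → ⨁ (map f L) ≈ ⨁ (map g L)
    map-cong []      f≈g = refl
    map-cong (x ∷ L) f≈g = ∙-cong (f≈g x) (map-cong L f≈g)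

    map-ε : ∀ {f : A → Carrier} L → (∀ x → f x ≈ ε) → ⨁ (map f L) ≈ ε
    map-ε []      f≈ε = refl
    map-ε (x ∷ L) f≈ε = trans (∙-cong (f≈ε x) (map-ε L f≈ε)) (identityˡ ε)

    map-∙ : ∀ (f g : A → Carrier) L → ⨁ (map (λ x → f x ∙ g x) L) ≈ ⨁ (map f L) ∙ ⨁ (map g L)
    map-∙ f g []      = sym (identityˡ ε)
    map-∙ f g (x ∷ L) = begin
      (f x ∙ g x) ∙ ⨁ (map (λ x → f x ∙ g x) L) ≈⟨ ∙-congˡ (map-∙ f g L) ⟩
      (f x ∙ g x) ∙ (⨁ (map f L) ∙ ⨁ (map g L)) ≈⟨ interchange (f x) (g x) _ _ ⟩
      (f x ∙ ⨁ (map f L)) ∙ (g x ∙ ⨁ (map g L)) ∎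

  ++-homo : ∀ xs ys → ⨁ (xs ++ ys) ≈ ⨁ xs ∙ ⨁ ys
  ++-homo []       ys = sym (identityˡ _)
  ++-homo (x ∷ xs) ys = trans (∙-congˡ (++-homo xs ys)) (sym (assoc _ _ _))

  module _ {a b} {A : Set a} {B : Set b} where

    map-concatMap : ∀ (h : B → Carrier) (g : A → List B) L →
      ⨁ (map h (concatMap g L)) ≈ ⨁ (map (λ x → ⨁ (map h (g x))) L)
    map-concatMap h g []      = refl
    map-concatMap h g (x ∷ L) = begin
      ⨁ (map h (g x ++ concatMap g L))             ≡⟨ ≡.cong ⨁ (ListP.map-++ h (g x) (concatMap g L)) ⟩
      ⨁ (map h (g x) ++ map h (concatMap g L))     ≈⟨ ++-homo (map h (g x)) _ ⟩
      ⨁ (map h (g x)) ∙ ⨁ (map h (concatMap g L)) ≈⟨ ∙-congˡ (map-concatMap h g L) ⟩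
      ⨁ (map h (g x)) ∙ ⨁ (map (λ x → ⨁ (map h (g x))) L) ∎

    map-map : ∀ (h : B → Carrier) (g : A → B) L → ⨁ (map h (map g L)) ≡ ⨁ (map (h ∘ g) L)
    map-map h g L = ≡.cong ⨁ (≡.sym (ListP.map-∘ L))

    exchange : ∀ (f : A → B → Carrier) L M →
      ⨁ (map (λ x → ⨁ (map (f x) M)) L) ≈ ⨁ (map (λ y → ⨁ (map (λ x → f x y) L)) M)
    exchange f []      M = sym (map-ε M (λ _ → refl))
    exchange f (x ∷ L) M = trans (∙-congˡ (exchange f L M)) (sym (map-∙ (f x) _ M))

  map-filter : ∀ {a p} {A : Set a} {P : Pred A p} (P? : Decidable P) (f g : A → Carrier) L →
    (∀ x → P x → g x ≈ f x) → (∀ x → ¬ P x → g x ≈ ε) → ⨁ (map f (filter P? L)) ≈ ⨁ (map g L)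
  map-filter P? f g []      _   _    = refl
  map-filter P? f g (x ∷ L) g≈f g≈ε with P? x
  ... | yes p = ∙-cong (sym (g≈f x p)) (map-filter P? f g L g≈f g≈ε)
  ... | no ¬p = trans (map-filter P? f g L g≈f g≈ε) (sym (trans (∙-congʳ (g≈ε x ¬p)) (identityˡ _)))

  allFin-suc-⨁ : ∀ {n} (h : Fin (suc n) → Carrier) →
    ⨁ (map h (allFin (suc n))) ≡ h Fin.zero ∙ ⨁ (map (h ∘ Fin.suc) (allFin n))
  allFin-suc-⨁ h = ≡.cong ⨁ (map-allFin-suc h)

  indicator : ∀ {n} (h : Fin n → Carrier) (x : Fin n) →
    ⨁ (map (λ j → if does (j Fin.≟ x) then h j else ε) (allFin n)) ≈ h x
  indicator {suc n} h Fin.zero = begin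
    ⨁ (map δ (allFin (suc n)))                  ≡⟨ allFin-suc-⨁ δ ⟩
    h Fin.zero ∙ ⨁ (map (δ ∘ Fin.suc) (allFin n)) ≈⟨ ∙-congˡ (map-ε (allFin n) (λ _ → refl)) ⟩
    h Fin.zero ∙ ε                               ≈⟨ identityʳ _ ⟩
    h Fin.zero                                   ∎
    where δ = λ j → if does (j Fin.≟ Fin.zero) then h j else ε
  indicator {suc n} h (Fin.suc x) = begin
    ⨁ (map δ (allFin (suc n)))            ≡⟨ allFin-suc-⨁ δ ⟩
    ε ∙ ⨁ (map (δ ∘ Fin.suc) (allFin n))  ≈⟨ identityˡ _ ⟩
    ⨁ (map (δ ∘ Fin.suc) (allFin n))      ≈⟨ indicator (h ∘ Fin.suc) x ⟩
    h (Fin.suc x)                         ∎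
    where δ = λ j → if does (j Fin.≟ Fin.suc x) then h j else ε

module ℕΣ = BigOperator ℕP.+-0-commutativeMonoid

sum-count : ∀ {n} (L : List (Fin n)) → sum (map (λ j → count j L) (allFin n)) ≡ length L
sum-count {n} []      = ℕΣ.map-ε (allFin n) (λ _ → ≡.refl)
sum-count {n} (x ∷ L) = begin
  sum (map (λ j → count j (x ∷ L)) (allFin n))
    ≡⟨ ℕΣ.map-cong (allFin n) (λ j → count-++ j (x ∷ []) L) ⟩
  sum (map (λ j → count j (x ∷ []) ℕ.+ count j L) (allFin n))
    ≡⟨ ℕΣ.map-∙ (λ j → count j (x ∷ [])) (λ j → count j L) (allFin n) ⟩
  sum (map (λ j → count j (x ∷ [])) (allFin n)) ℕ.+ sum (map (λ j → count j L) (allFin n))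
    ≡⟨ ≡.cong₂ ℕ._+_ (ℕΣ.indicator (λ _ → 1) x) (sum-count L) ⟩
  suc (length L) ∎
  where open ≡.≡-Reasoning

module _ {a} {A : Set a} (c : A → ℕ) where

  sum≤length : ∀ J → All (λ j → c j ≤ 1) J → sum (map c J) ≤ length J
  sum≤length []      []         = z≤n
  sum≤length (x ∷ J) (p ∷ ≤1) = ℕP.+-mono-≤ p (sum≤length J ≤1)

  length≤sum : ∀ J → All (λ j → 1 ≤ c j) J → length J ≤ sum (map c J)
  length≤sum []      []         = z≤n
  length≤sum (x ∷ J) (p ∷ ≥1) = ℕP.+-mono-≤ p (length≤sum J ≥1)

  sum<length : ∀ J → All (λ j → c j ≤ 1) J → Any (λ j → c j ≡ 0) J → sum (map c J) < length J
  sum<length (x ∷ J) (_ ∷ ≤1) (here cx≡0) rewrite cx≡0 = s≤s (sum≤length J ≤1)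
  sum<length (x ∷ J) (p ∷ ≤1) (there z)   = ℕP.+-mono-≤-< p (sum<length J ≤1 z)

  length<sum : ∀ J → All (λ j → 1 ≤ c j) J → Any (λ j → 2 ≤ c j) J → length J < sum (map c J)
  length<sum (x ∷ J) (_ ∷ ≥1) (here p)  = ℕP.+-mono-≤ p (length≤sum J ≥1)
  length<sum (x ∷ J) (p ∷ ≥1) (there q) = ℕP.+-mono-≤-< p (length<sum J ≥1 q)

  all≡1 : ∀ J → All (λ j → c j ≤ 1) J → sum (map c J) ≡ length J → All (λ j → c j ≡ 1) J
  all≡1 J ≤1 eq with Any.any? (λ j → c j ℕ.≟ 0) J
  ... | yes z  = ⊥-elim (ℕP.<-irrefl eq (sum<length J ≤1 z))
  ... | no ¬z  = All.zipWith ≤1∧≢0⇒≡1 (≤1 , ¬Any⇒All¬ J ¬z)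
    where
    ≤1∧≢0⇒≡1 : ∀ {k} → k ≤ 1 × k ≢ 0 → k ≡ 1
    ≤1∧≢0⇒≡1 (z≤n , k≢0)     = ⊥-elim (k≢0 ≡.refl)
    ≤1∧≢0⇒≡1 (s≤s z≤n , _) = ≡.refl

  any≡0 : ∀ J → Any (λ j → 2 ≤ c j) J → sum (map c J) ≡ length J → Any (λ j → c j ≡ 0) J
  any≡0 J ≥2 eq with Any.any? (λ j → c j ℕ.≟ 0) J
  ... | yes z  = z
  ... | no ¬z  = ⊥-elim (ℕP.<-irrefl (≡.sym eq)
                   (length<sum J (All.map ℕP.n≢0⇒n>0 (¬Any⇒All¬ J ¬z)) ≥2))

module FiniteSums {c ℓ} (R : CommutativeSemiring c ℓ) where
  open CommutativeSemiring R
  open import Algebra.Definitions.RawSemiring rawSemiring using (_^_)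
  open import Relation.Binary.Reasoning.Setoid setoid

  module Σ = BigOperator +-commutativeMonoid
  module Π = BigOperator *-commutativeMonoid
  private
    Σ = Σ.⨁
    Π = Π.⨁

  module _ {a} {A : Set a} where

    *-distribˡ-Σ : ∀ k (f : A → Carrier) L → k * Σ (map f L) ≈ Σ (map (λ x → k * f x) L)
    *-distribˡ-Σ k f []      = zeroʳ k
    *-distribˡ-Σ k f (x ∷ L) = trans (distribˡ _ _ _) (+-congˡ (*-distribˡ-Σ k f L))

    *-distribʳ-Σ : ∀ k (f : A → Carrier) L → Σ (map f L) * k ≈ Σ (map (λ x → f x * k) L)
    *-distribʳ-Σ k f L =
      trans (*-comm _ _) (trans (*-distribˡ-Σ k f L) (Σ.map-cong L (λ x → *-comm k (f x))))

    Π-zero : ∀ (f : A → Carrier) L → Any (λ x → f x ≈ 0#) L → Π (map f L) ≈ 0#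
    Π-zero f (x ∷ L) (here fx≈0) = trans (*-congʳ fx≈0) (zeroˡ _)
    Π-zero f (x ∷ L) (there any) = trans (*-congˡ (Π-zero f L any)) (zeroʳ _)

  Π-Σ-distrib : ∀ {b} {B : Set b} (Bs : List B) k (g : Fin k → B → Carrier) →
    Π (map (λ i → Σ (map (g i) Bs)) (allFin k)) ≈
    Σ (map (λ v → Π (map (λ i → g i (lookup v i)) (allFin k))) (vecsOver Bs k))
  Π-Σ-distrib Bs zero    g = sym (+-identityʳ _)
  Π-Σ-distrib Bs (suc k) g = begin
    Π (map (λ i → Σ (map (g i) Bs)) (allFin (suc k)))
      ≡⟨ Π.allFin-suc-⨁ (λ i → Σ (map (g i) Bs)) ⟩
    Σ (map (g Fin.zero) Bs) * Π (map (λ i → Σ (map (g (Fin.suc i)) Bs)) (allFin k))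
      ≈⟨ *-congˡ (Π-Σ-distrib Bs k (g ∘ Fin.suc)) ⟩
    Σ (map (g Fin.zero) Bs) * Σ (map choices V)
      ≈⟨ *-distribʳ-Σ _ (g Fin.zero) Bs ⟩
    Σ (map (λ b → g Fin.zero b * Σ (map choices V)) Bs)
      ≈⟨ Σ.map-cong Bs (λ b → *-distribˡ-Σ (g Fin.zero b) choices V) ⟩
    Σ (map (λ b → Σ (map (λ v → g Fin.zero b * choices v) V)) Bs)
      ≈⟨ Σ.map-cong Bs (λ b → reflexive (≡.sym (≡.trans (Σ.map-map choices′ (b ∷_) V)
           (≡.cong Σ (ListP.map-cong (λ v → Π.allFin-suc-⨁ (λ i → g i (lookup (b ∷ v) i))) V))))) ⟩
    Σ (map (λ b → Σ (map choices′ (map (b ∷_) V))) Bs)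
      ≈⟨ Σ.map-concatMap choices′ (λ b → map (b ∷_) V) Bs ⟨
    Σ (map choices′ (vecsOver Bs (suc k))) ∎
    where
    V = vecsOver Bs k
    choices = λ v → Π (map (λ i → g (Fin.suc i) (lookup v i)) (allFin k))
    choices′ = λ (v : Vec _ (suc k)) → Π (map (λ i → g i (lookup v i)) (allFin (suc k)))

  Π-count : ∀ {n} (h : Fin n → Carrier) L → Π (map h L) ≈ Π (map (λ j → h j ^ count j L) (allFin n))
  Π-count {n} h []      = sym (Π.map-ε (allFin n) (λ _ → refl))
  Π-count {n} h (x ∷ L) = begin
    h x * Π (map h L)
      ≈⟨ *-cong (sym (Π.indicator h x)) (Π-count h L) ⟩
    Π (map δ (allFin n)) * Π (map (λ j → h j ^ count j L) (allFin n))
      ≈⟨ Π.map-∙ δ _ (allFin n) ⟨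
    Π (map (λ j → δ j * h j ^ count j L) (allFin n))
      ≈⟨ Π.map-cong (allFin n) (λ j → if-*-^ (does (j Fin.≟ x)) (h j) (count j L)) ⟩
    Π (map (λ j → h j ^ count j (x ∷ L)) (allFin n)) ∎
    where
    δ = λ j → if does (j Fin.≟ x) then h j else 1#
    if-*-^ : ∀ b y k → (if b then y else 1#) * y ^ k ≈ y ^ (if b then suc k else k)
    if-*-^ true  y k = refl
    if-*-^ false y k = *-identityˡ _

module Series {c ℓ} (F : CharZeroField c ℓ) where
  open Field F
  open FiniteSums commutativeSemiring
  open import Algebra.Properties.CommutativeSemigroup *-commutativeSemigroup using (x∙yz≈y∙xz; interchange)
  open import Relation.Binary.Reasoning.Setoid setoid

  infix 4 _≐_
  _≐_ : ∀ {n} → Series n → Series n → Set ℓ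
  f ≐ g = ∀ m → f m ≈ g m

  coeff₀ coeff₁ : ∀ {n} → Series (suc n) → Series n
  coeff₀ f m = f (0 ∷ m)
  coeff₁ f m = f (1 ∷ m)

  if-==ₘ-∷ : ∀ {n} x y (a b : Monomial n) →
    (if (x ∷ a) ==ₘ (y ∷ b) then 1# else 0#) ≡ (if does (x ℕ.≟ y) ∧ (a ==ₘ b) then 1# else 0#)
  if-==ₘ-∷ x y a b = ≡.cong (λ t → if t then 1# else 0#)
    (≡.trans (isYes≗does _) (≡.cong (does (x ℕ.≟ y) ∧_) (≡.sym (isYes≗does _))))

  oneSeries-0∷ : ∀ {n} (m : Monomial n) → oneSeries (0 ∷ m) ≡ oneSeries m
  oneSeries-0∷ m = if-==ₘ-∷ 0 0 m (replicate _ 0)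

  oneSeries-suc∷ : ∀ {n} k (m : Monomial n) → oneSeries (suc k ∷ m) ≡ 0#
  oneSeries-suc∷ k m = if-==ₘ-∷ (suc k) 0 m (replicate _ 0)

  var-zero-0∷ : ∀ {n} (m : Monomial n) → var Fin.zero (0 ∷ m) ≡ 0#
  var-zero-0∷ m = if-==ₘ-∷ 0 1 m (replicate _ 0)

  var-zero-1∷ : ∀ {n} (m : Monomial n) → var Fin.zero (1 ∷ m) ≡ oneSeries m
  var-zero-1∷ m = if-==ₘ-∷ 1 1 m (replicate _ 0)

  var-suc-0∷ : ∀ {n} i (m : Monomial n) → var (Fin.suc i) (0 ∷ m) ≡ var i m
  var-suc-0∷ i m = if-==ₘ-∷ 0 0 m (Vec.updateAt (replicate _ 0) i (λ _ → 1))

  var-suc-1∷ : ∀ {n} i (m : Monomial n) → var (Fin.suc i) (1 ∷ m) ≡ 0#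
  var-suc-1∷ i m = if-==ₘ-∷ 1 0 m (Vec.updateAt (replicate _ 0) i (λ _ → 1))

  ⊗-∷ : ∀ {n} (f g : Series (suc n)) k m →
    (f ⊗ g) (k ∷ m) ≈ Σ (map (λ i → ((λ a → f (i ∷ a)) ⊗ (λ b → g ((k ℕ.∸ i) ∷ b))) m) (upTo (suc k)))
  ⊗-∷ f g k m = begin
    Σ (map h (concatMap (λ i → map (i ∷_) (below m)) (upTo (suc k))))
      ≈⟨ Σ.map-concatMap h (λ i → map (i ∷_) (below m)) (upTo (suc k)) ⟩
    Σ (map (λ i → Σ (map h (map (i ∷_) (below m)))) (upTo (suc k)))
      ≡⟨ ≡.cong Σ (ListP.map-cong (λ i → Σ.map-map h (i ∷_) (below m)) (upTo (suc k))) ⟩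
    Σ (map (λ i → ((λ a → f (i ∷ a)) ⊗ (λ b → g ((k ℕ.∸ i) ∷ b))) m) (upTo (suc k))) ∎
    where h = λ a → f a * g ((k ∷ m) ∸ᵥ a)

  ⊗-coeff₀ : ∀ {n} (f g : Series (suc n)) → coeff₀ (f ⊗ g) ≐ coeff₀ f ⊗ coeff₀ g
  ⊗-coeff₀ f g m = trans (⊗-∷ f g 0 m) (+-identityʳ _)

  ⊗-coeff₁ : ∀ {n} (f g : Series (suc n)) m →
    coeff₁ (f ⊗ g) m ≈ (coeff₀ f ⊗ coeff₁ g) m + (coeff₁ f ⊗ coeff₀ g) m
  ⊗-coeff₁ f g m = trans (⊗-∷ f g 1 m) (+-congˡ (+-identityʳ _))

  ⊗-cong : ∀ {n} {f f′ g g′ : Series n} → f ≐ f′ → g ≐ g′ → f ⊗ g ≐ f′ ⊗ g′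
  ⊗-cong f≐f′ g≐g′ m = Σ.map-cong (below m) (λ a → *-cong (f≐f′ a) (g≐g′ (m ∸ᵥ a)))

  ·-⊗ : ∀ {n} k (f g : Series n) → (k · f) ⊗ g ≐ k · (f ⊗ g)
  ·-⊗ k f g m = trans (Σ.map-cong (below m) (λ a → *-assoc _ _ _)) (sym (*-distribˡ-Σ k _ (below m)))

  ⊗-· : ∀ {n} k (f g : Series n) → f ⊗ (k · g) ≐ k · (f ⊗ g)
  ⊗-· k f g m = trans (Σ.map-cong (below m) (λ a → x∙yz≈y∙xz _ k _)) (sym (*-distribˡ-Σ k _ (below m)))

  ⊗-zeroʳ : ∀ {n} (f : Series n) → f ⊗ zeroSeries ≐ zeroSeries
  ⊗-zeroʳ f m = Σ.map-ε (below m) (λ a → zeroʳ _)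

  ⊗-identityˡ : ∀ {n} (g : Series n) → oneSeries ⊗ g ≐ g
  ⊗-identityˡ g []               = trans (+-identityʳ _) (*-identityˡ _)
  ⊗-identityˡ {suc n} g (k ∷ m) = begin
    (oneSeries ⊗ g) (k ∷ m)                ≈⟨ ⊗-∷ oneSeries g k m ⟩
    Σ (map H (upTo (suc k)))               ≡⟨ ≡.cong Σ (map-upTo-suc H k) ⟩
    H 0 + Σ (map (H ∘ suc) (upTo k))       ≈⟨ +-cong H0≈g (Σ.map-ε (upTo k) H[suc]≈0) ⟩
    g (k ∷ m) + 0#                         ≈⟨ +-identityʳ _ ⟩
    g (k ∷ m)                              ∎
    where
    H : ℕ → Carrier
    H i = ((λ a → oneSeries (i ∷ a)) ⊗ (λ b → g ((k ℕ.∸ i) ∷ b))) m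
    H0≈g : H 0 ≈ g (k ∷ m)
    H0≈g = trans (⊗-cong {g′ = λ b → g (k ∷ b)} (λ a → reflexive (oneSeries-0∷ a)) (λ _ → refl) m) (⊗-identityˡ (λ b → g (k ∷ b)) m)
    H[suc]≈0 : ∀ i → H (suc i) ≈ 0#
    H[suc]≈0 i = Σ.map-ε (below m) (λ a → trans (*-congʳ (reflexive (oneSeries-suc∷ i a))) (zeroˡ _))

  ^ₛ-coeff₀ : ∀ {n} (f : Series (suc n)) k → coeff₀ (f ^ₛ k) ≐ coeff₀ f ^ₛ k
  ^ₛ-coeff₀ f zero    m = reflexive (oneSeries-0∷ m)
  ^ₛ-coeff₀ f (suc k) m = trans (⊗-coeff₀ f (f ^ₛ k) m) (⊗-cong (λ _ → refl) (^ₛ-coeff₀ f k) m)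

  module _ {n} (f : Series (suc n)) (a : Carrier) (coeff₁f≐a : coeff₁ f ≐ a · oneSeries) where

    coeff₁⊗coeff₀-^ₛ : ∀ k → coeff₁ f ⊗ coeff₀ (f ^ₛ k) ≐ a · (coeff₀ f ^ₛ k)
    coeff₁⊗coeff₀-^ₛ k m = begin
      (coeff₁ f ⊗ coeff₀ (f ^ₛ k)) m        ≈⟨ ⊗-cong coeff₁f≐a (^ₛ-coeff₀ f k) m ⟩
      ((a · oneSeries) ⊗ (coeff₀ f ^ₛ k)) m ≈⟨ ·-⊗ a oneSeries (coeff₀ f ^ₛ k) m ⟩
      a * (oneSeries ⊗ (coeff₀ f ^ₛ k)) m   ≈⟨ *-congˡ (⊗-identityˡ (coeff₀ f ^ₛ k) m) ⟩
      a * (coeff₀ f ^ₛ k) m                 ∎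

    ^ₛ-coeff₁ : ∀ k → coeff₁ (f ^ₛ suc k) ≐ (embedℕ commRing (suc k) * a) · (coeff₀ f ^ₛ k)
    ^ₛ-coeff₁ zero m = begin
      coeff₁ (f ⊗ oneSeries) m
        ≈⟨ ⊗-coeff₁ f oneSeries m ⟩
      (coeff₀ f ⊗ coeff₁ oneSeries) m + (coeff₁ f ⊗ coeff₀ oneSeries) m
        ≈⟨ +-cong coeff₁-oneSeries (coeff₁⊗coeff₀-^ₛ 0 m) ⟩
      0# + a * oneSeries m
        ≈⟨ +-identityˡ _ ⟩
      a * oneSeries m
        ≈⟨ *-congʳ (trans (*-congʳ (+-identityʳ 1#)) (*-identityˡ a)) ⟨
      ((1# + 0#) * a) * oneSeries m ∎
      where
      coeff₁-oneSeries : (coeff₀ f ⊗ coeff₁ oneSeries) m ≈ 0#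
      coeff₁-oneSeries =
        trans (⊗-cong {g′ = zeroSeries} (λ _ → refl) (λ b → reflexive (oneSeries-suc∷ 0 b)) m) (⊗-zeroʳ (coeff₀ f) m)
    ^ₛ-coeff₁ (suc k) m = begin
      coeff₁ (f ⊗ (f ^ₛ suc k)) m
        ≈⟨ ⊗-coeff₁ f (f ^ₛ suc k) m ⟩
      (coeff₀ f ⊗ coeff₁ (f ^ₛ suc k)) m + (coeff₁ f ⊗ coeff₀ (f ^ₛ suc k)) m
        ≈⟨ +-cong (trans (⊗-cong (λ _ → refl) (^ₛ-coeff₁ k) m) (⊗-· (e * a) (coeff₀ f) (coeff₀ f ^ₛ k) m))
                  (coeff₁⊗coeff₀-^ₛ (suc k) m) ⟩
      (e * a) * X + a * X                     ≈⟨ distribʳ X (e * a) a ⟨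
      (e * a + a) * X                         ≈⟨ *-congʳ (+-cong refl (*-identityˡ a)) ⟨
      (e * a + 1# * a) * X                    ≈⟨ *-congʳ (trans (*-congʳ (+-comm 1# e)) (distribʳ a e 1#)) ⟨
      ((1# + e) * a) * X ∎
      where
      e = embedℕ commRing (suc k)
      X = (coeff₀ f ^ₛ suc k) m

    expₛ-coeff₁ : coeff₁ (expₛ f) ≐ a · expₛ (coeff₀ f)
    expₛ-coeff₁ m = begin
      Σ (map T (upTo (suc (suc d))))                ≡⟨ ≡.cong Σ (map-upTo-suc T (suc d)) ⟩
      T 0 + Σ (map (T ∘ suc) (upTo (suc d)))        ≈⟨ +-cong T0≈0 (Σ.map-cong (upTo (suc d)) T[suc]≈a*T′) ⟩
      0# + Σ (map (λ k → a * T′ k) (upTo (suc d)))  ≈⟨ +-identityˡ _ ⟩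
      Σ (map (λ k → a * T′ k) (upTo (suc d)))       ≈⟨ *-distribˡ-Σ a T′ (upTo (suc d)) ⟨
      a * expₛ (coeff₀ f) m                          ∎
      where
      d = degree m
      T T′ : ℕ → Carrier
      T k = invFact k * (f ^ₛ k) (1 ∷ m)
      T′ k = invFact k * (coeff₀ f ^ₛ k) m
      T0≈0 : T 0 ≈ 0#
      T0≈0 = trans (*-congˡ (reflexive (oneSeries-suc∷ 0 m))) (zeroʳ _)
      -- the factor k+1 from ^ₛ-coeff₁ cancels the 1/(k+1) in 1/(k+1)!
      T[suc]≈a*T′ : ∀ k → T (suc k) ≈ a * T′ k
      T[suc]≈a*T′ k = begin
        (invSuc k * invFact k) * (f ^ₛ suc k) (1 ∷ m) ≈⟨ *-congˡ (^ₛ-coeff₁ k m) ⟩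
        (invSuc k * invFact k) * ((e * a) * X)        ≈⟨ *-congˡ (*-assoc _ _ _) ⟩
        (invSuc k * invFact k) * (e * (a * X))        ≈⟨ interchange _ _ _ _ ⟩
        (invSuc k * e) * (invFact k * (a * X))        ≈⟨ *-congʳ (trans (*-comm _ _) (inverse e (charZero k))) ⟩
        1# * (invFact k * (a * X))                    ≈⟨ *-identityˡ _ ⟩
        invFact k * (a * X)                           ≈⟨ x∙yz≈y∙xz _ _ _ ⟩
        a * (invFact k * X)                           ∎
        where
        e = embedℕ commRing (suc k)
        X = (coeff₀ f ^ₛ k) m

  Σₛ-apply : ∀ {n} (L : List (Series n)) m → Σₛ L m ≡ Σ (map (λ g → g m) L)
  Σₛ-apply []      m = ≡.refl
  Σₛ-apply (g ∷ L) m = ≡.cong (g m +_) (Σₛ-apply L m)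

  IsLinear : ∀ {n} → (Fin n → Carrier) → Series n → Set ℓ
  IsLinear {n} a f = f ≐ λ m → Σ (map (λ i → a i * var i m) (allFin n))

  module _ {n} {a : Fin (suc n) → Carrier} {f : Series (suc n)} (lin : IsLinear a f) where

    IsLinear-coeff₁ : coeff₁ f ≐ a Fin.zero · oneSeries
    IsLinear-coeff₁ m = begin
      f (1 ∷ m)
        ≈⟨ lin (1 ∷ m) ⟩
      Σ (map (λ i → a i * var i (1 ∷ m)) (allFin (suc n)))
        ≡⟨ Σ.allFin-suc-⨁ (λ i → a i * var i (1 ∷ m)) ⟩
      a Fin.zero * var Fin.zero (1 ∷ m) + Σ (map (λ i → a (Fin.suc i) * var (Fin.suc i) (1 ∷ m)) (allFin n))
        ≈⟨ +-cong (*-congˡ (reflexive (var-zero-1∷ m)))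
                  (Σ.map-ε (allFin n) (λ i → trans (*-congˡ (reflexive (var-suc-1∷ i m))) (zeroʳ _))) ⟩
      a Fin.zero * oneSeries m + 0#
        ≈⟨ +-identityʳ _ ⟩
      a Fin.zero * oneSeries m ∎

    IsLinear-coeff₀ : IsLinear (a ∘ Fin.suc) (coeff₀ f)
    IsLinear-coeff₀ m = begin
      f (0 ∷ m)
        ≈⟨ lin (0 ∷ m) ⟩
      Σ (map (λ i → a i * var i (0 ∷ m)) (allFin (suc n)))
        ≡⟨ Σ.allFin-suc-⨁ (λ i → a i * var i (0 ∷ m)) ⟩
      a Fin.zero * var Fin.zero (0 ∷ m) + Σ (map (λ i → a (Fin.suc i) * var (Fin.suc i) (0 ∷ m)) (allFin n))
        ≈⟨ +-cong (trans (*-congˡ (reflexive (var-zero-0∷ m))) (zeroʳ _))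
                  (Σ.map-cong (allFin n) (λ i → *-congˡ (reflexive (var-suc-0∷ i m)))) ⟩
      0# + Σ (map (λ i → a (Fin.suc i) * var i m) (allFin n))
        ≈⟨ +-identityˡ _ ⟩
      Σ (map (λ i → a (Fin.suc i) * var i m) (allFin n)) ∎

  coeffAllOnes-expₛ-linear : ∀ {n} {a : Fin n → Carrier} {f : Series n} →
    IsLinear a f → coeffAllOnes (expₛ f) ≈ Π (map a (allFin n))
  coeffAllOnes-expₛ-linear {zero}          lin = trans (+-identityʳ _) (*-identityˡ _)
  coeffAllOnes-expₛ-linear {suc n} {a} {f} lin = begin
    expₛ f (1 ∷ replicate n 1)                       ≈⟨ expₛ-coeff₁ f (a Fin.zero) (IsLinear-coeff₁ lin) _ ⟩
    a Fin.zero * expₛ (coeff₀ f) (replicate n 1)     ≈⟨ *-congˡ (coeffAllOnes-expₛ-linear (IsLinear-coeff₀ lin)) ⟩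
    a Fin.zero * Π (map (a ∘ Fin.suc) (allFin n))    ≡⟨ Π.allFin-suc-⨁ a ⟨
    Π (map a (allFin (suc n)))                       ∎

module SignWeight {c ℓ} (F : CharZeroField c ℓ) where
  open Field F
  open FiniteSums commutativeSemiring
  open import Algebra.Definitions.RawSemiring (CommutativeSemiring.rawSemiring commutativeSemiring) using (_^_)
  open import Algebra.Properties.Ring ring using (-1*x≈-x; -‿involutive)
  open import Relation.Binary.Reasoning.Setoid setoid

  notIn⇒count≡0 : ∀ {n} (x : Fin n) L → notIn x L ≡ true → count x L ≡ 0
  notIn⇒count≡0 x []       _ = ≡.refl
  notIn⇒count≡0 x (y ∷ ys) h with x Fin.≟ y
  ... | no _ = notIn⇒count≡0 x ys h

  ¬notIn⇒count≥1 : ∀ {n} (x : Fin n) L → notIn x L ≡ false → 1 ≤ count x L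
  ¬notIn⇒count≥1 x (y ∷ ys) h with x Fin.≟ y
  ... | yes _ = s≤s z≤n
  ... | no _  = ¬notIn⇒count≥1 x ys h

  distinct⇒count≤1 : ∀ {n} (L : List (Fin n)) → distinct L ≡ true → ∀ j → count j L ≤ 1
  distinct⇒count≤1 []       _ j = z≤n
  distinct⇒count≤1 (x ∷ xs) d j with notIn x xs in x∉xs
  ... | true with j Fin.≟ x
  ...   | yes ≡.refl = s≤s (ℕP.≤-reflexive (notIn⇒count≡0 x xs x∉xs))
  ...   | no _       = distinct⇒count≤1 xs d j

  ¬distinct⇒count≥2 : ∀ {n} (L : List (Fin n)) → ¬ distinct L ≡ true → ∃ λ j → 2 ≤ count j L
  ¬distinct⇒count≥2 []       nd = ⊥-elim (nd ≡.refl)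
  ¬distinct⇒count≥2 (x ∷ xs) nd with notIn x xs in x∉xs
  ... | false = x , ℕP.≤-trans (s≤s (¬notIn⇒count≥1 x xs x∉xs)) (ℕP.≤-reflexive (≡.sym (count-self x xs)))
  ¬distinct⇒count≥2 (x ∷ xs) nd | true with ¬distinct⇒count≥2 xs nd
  ...   | j , j≥2 = j , ℕP.≤-trans j≥2 (count≤count-∷ j x xs)

  allSigns≡vecsOver : ∀ n → allSigns n ≡ vecsOver (true ∷ false ∷ []) n
  allSigns≡vecsOver zero    = ≡.refl
  allSigns≡vecsOver (suc n) = ≡.cong (λ V → concatMap (λ b → map (b ∷_) V) (true ∷ false ∷ [])) (allSigns≡vecsOver n)

  spinMoment : ℕ → Carrier
  spinMoment k = Σ (map (λ b → spin b ^ k) (true ∷ false ∷ []))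

  spinMoment-1 : spinMoment 1 ≈ 0#
  spinMoment-1 = trans (+-cong (*-identityʳ 1#) (trans (+-identityʳ _) (*-identityʳ _))) (-‿inverseʳ 1#)

  half*spinMoment-2 : half * spinMoment 2 ≈ 1#
  half*spinMoment-2 = trans (*-congˡ spinMoment-2≈2) (trans (*-comm _ _) (inverse (embedℕ commRing 2) (charZero 1)))
    where
    spinMoment-2≈2 : spinMoment 2 ≈ 1# + (1# + 0#)
    spinMoment-2≈2 = +-cong (trans (*-congˡ (*-identityʳ 1#)) (*-identityʳ 1#))
      (+-congʳ (trans (*-congˡ (*-identityʳ _)) (trans (-1*x≈-x (- 1#)) (-‿involutive 1#))))

  signWeight : ∀ {n} → Vec (Fin n) n → Carrier
  signWeight {n} σ =
    Σ (map (λ s → Π (map (λ i → half * (spin (lookup s i) * spin (lookup s (lookup σ i)))) (allFin n))) (allSigns n))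

  -- s_j occurs once as s_i and (count j σ) times as s_(σ i)
  signWeight-moments : ∀ {n} (σ : Vec (Fin n) n) →
    signWeight σ ≈ Π (map (λ j → half * spinMoment (suc (count j (toList σ)))) (allFin n))
  signWeight-moments {n} σ = begin
    signWeight σ
      ≈⟨ Σ.map-cong (allSigns n) factorise ⟩
    Σ (map (λ s → Π halves * spinPowers s) (allSigns n))
      ≈⟨ *-distribˡ-Σ (Π halves) spinPowers (allSigns n) ⟨
    Π halves * Σ (map spinPowers (allSigns n))
      ≡⟨ ≡.cong (λ V → Π halves * Σ (map spinPowers V)) (allSigns≡vecsOver n) ⟩
    Π halves * Σ (map spinPowers (vecsOver (true ∷ false ∷ []) n))
      ≈⟨ *-congˡ (Π-Σ-distrib (true ∷ false ∷ []) n (λ j b → spin b ^ e j)) ⟨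
    Π halves * Π (map (λ j → spinMoment (e j)) (allFin n))
      ≈⟨ Π.map-∙ (λ _ → half) (λ j → spinMoment (e j)) (allFin n) ⟨
    Π (map (λ j → half * spinMoment (e j)) (allFin n))
      ≡⟨ ≡.cong Π (ListP.map-cong (λ j → ≡.cong (λ k → half * spinMoment k) (e≡1+count j)) (allFin n)) ⟩
    Π (map (λ j → half * spinMoment (suc (count j T))) (allFin n)) ∎
    where
    T = toList σ
    halves = map (λ (_ : Fin n) → half) (allFin n)
    e : Fin n → ℕ
    e j = count j (allFin n ++ T)
    e≡1+count : ∀ j → e j ≡ suc (count j T)
    e≡1+count j = ≡.trans (count-++ j (allFin n) T) (≡.cong (ℕ._+ count j T) (count-allFin j))
    spinPowers : Vec Bool n → Carrier
    spinPowers s = Π (map (λ j → spin (lookup s j) ^ e j) (allFin n))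
    factorise : ∀ s → Π (map (λ i → half * (spin (lookup s i) * spin (lookup s (lookup σ i)))) (allFin n))
                     ≈ Π halves * spinPowers s
    factorise s = begin
      Π (map (λ i → half * (h i * h (lookup σ i))) (allFin n))
        ≈⟨ Π.map-∙ (λ _ → half) _ (allFin n) ⟩
      Π halves * Π (map (λ i → h i * h (lookup σ i)) (allFin n))
        ≈⟨ *-congˡ (Π.map-∙ h (h ∘ lookup σ) (allFin n)) ⟩
      Π halves * (Π (map h (allFin n)) * Π (map (h ∘ lookup σ) (allFin n)))
        ≡⟨ ≡.cong (λ t → Π halves * (Π (map h (allFin n)) * Π t)) (map-lookup-allFin h σ) ⟩
      Π halves * (Π (map h (allFin n)) * Π (map h T))
        ≈⟨ *-congˡ (Π.++-homo (map h (allFin n)) (map h T)) ⟨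
      Π halves * Π (map h (allFin n) ++ map h T)
        ≡⟨ ≡.cong (λ t → Π halves * Π t) (ListP.map-++ h (allFin n) T) ⟨
      Π halves * Π (map h (allFin n ++ T))
        ≈⟨ *-congˡ (Π-count h (allFin n ++ T)) ⟩
      Π halves * spinPowers s ∎
      where h = λ j → spin (lookup s j)

  module _ {n} (σ : Vec (Fin n) n) where
    private
      T = toList σ

      sum-count≡length : sum (map (λ j → count j T) (allFin n)) ≡ length (allFin n)
      sum-count≡length =
        ≡.trans (sum-count T) (≡.trans (VecP.length-toList σ) (≡.sym (ListP.length-tabulate (λ i → i))))

    signWeight-distinct : distinct T ≡ true → signWeight σ ≈ 1#
    signWeight-distinct d = begin
      signWeight σ                                                   ≈⟨ signWeight-moments σ ⟩
      Π (map (λ j → half * spinMoment (suc (count j T))) (allFin n)) ≈⟨ Π.map-ε (allFin n) half*spinMoment≈1 ⟩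
      1#                                                             ∎
      where
      count≡1 : All (λ j → count j T ≡ 1) (allFin n)
      count≡1 = all≡1 (λ j → count j T) (allFin n)
        (All.tabulate (λ {j} _ → distinct⇒count≤1 T d j)) sum-count≡length
      half*spinMoment≈1 : ∀ j → half * spinMoment (suc (count j T)) ≈ 1#
      half*spinMoment≈1 j = trans (reflexive (≡.cong (λ k → half * spinMoment (suc k)) (All.lookup count≡1 (∈-allFin j))))
                                  half*spinMoment-2

    -- a repeated value of σ forces, by pigeonhole, a missed value j, whose factor is half * spinMoment 1 = 0
    signWeight-¬distinct : ¬ distinct T ≡ true → signWeight σ ≈ 0#
    signWeight-¬distinct nd = begin
      signWeight σ                                                   ≈⟨ signWeight-moments σ ⟩
      Π (map (λ j → half * spinMoment (suc (count j T))) (allFin n)) ≈⟨ Π-zero _ (allFin n) (Any.map vanishes missed) ⟩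
      0#                                                             ∎
      where
      repeated : Any (λ j → 2 ≤ count j T) (allFin n)
      repeated with j , j≥2 ← ¬distinct⇒count≥2 T nd = Any.map (λ { ≡.refl → j≥2 }) (∈-allFin j)
      missed : Any (λ j → count j T ≡ 0) (allFin n)
      missed = any≡0 (λ j → count j T) (allFin n) repeated sum-count≡length
      vanishes : ∀ {j} → count j T ≡ 0 → half * spinMoment (suc (count j T)) ≈ 0#
      vanishes count≡0 rewrite count≡0 = trans (*-congˡ spinMoment-1) (zeroʳ half)

module Gaussian {c ℓ} (F : CharZeroField c ℓ) {n} (A : Field.Matrix F n) where
  open Field F
  open FiniteSums commutativeSemiring
  open Series F
  open SignWeight F
  open import Relation.Binary.Reasoning.Setoid setoid

  allVecs≡vecsOver : ∀ n k → allVecs n k ≡ vecsOver (allFin n) k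
  allVecs≡vecsOver n zero    = ≡.refl
  allVecs≡vecsOver n (suc k) = ≡.cong (λ V → concatMap (λ i → map (i ∷_) V) (allFin n)) (allVecs≡vecsOver n k)

  entryProduct : Vec (Fin n) n → Carrier
  entryProduct σ = Π (map (λ i → A i (lookup σ i)) (allFin n))

  weightedSum : Carrier
  weightedSum = Σ (map (λ σ → signWeight σ * entryProduct σ) (allVecs n n))

  perm≈weightedSum : perm A ≈ weightedSum
  perm≈weightedSum = Σ.map-filter (λ σ → distinct (toList σ) Data.Bool.≟ true) entryProduct
    (λ σ → signWeight σ * entryProduct σ) (allVecs n n)
    (λ σ d → trans (*-congʳ (signWeight-distinct σ d)) (*-identityˡ _))
    (λ σ nd → trans (*-congʳ (signWeight-¬distinct σ nd)) (zeroˡ _))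

  spins : Vec Bool n → Fin n → Fin n → Carrier
  spins s i j = spin (lookup s i) * spin (lookup s j)

  linearCoeff : Vec Bool n → Fin n → Fin n → Carrier
  linearCoeff s i j = half * (spins s i j * A i j)

  quadForm-linear : ∀ s → IsLinear (λ i → Σ (map (linearCoeff s i) (allFin n))) (quadForm (XA A) s)
  quadForm-linear s m = begin
    half * Σₛ terms m
      ≡⟨ ≡.cong (half *_) (Σₛ-apply terms m) ⟩
    half * Σ (map (λ g → g m) terms)
      ≈⟨ *-congˡ (Σ.map-concatMap (λ g → g m) row (allFin n)) ⟩
    half * Σ (map (λ i → Σ (map (λ g → g m) (row i))) (allFin n))
      ≡⟨ ≡.cong (λ t → half * Σ t) (ListP.map-cong (λ i → Σ.map-map (λ g → g m) (λ j → spins s i j · XA A i j) (allFin n)) (allFin n)) ⟩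
    half * Σ (map (λ i → Σ (map (λ j → spins s i j * (A i j * var i m)) (allFin n))) (allFin n))
      ≈⟨ *-distribˡ-Σ half _ (allFin n) ⟩
    Σ (map (λ i → half * Σ (map (λ j → spins s i j * (A i j * var i m)) (allFin n))) (allFin n))
      ≈⟨ Σ.map-cong (allFin n) (λ i → trans (*-distribˡ-Σ half _ (allFin n))
           (trans (Σ.map-cong (allFin n) (λ j → reassoc (spins s i j) (A i j) (var i m)))
                  (sym (*-distribʳ-Σ (var i m) (linearCoeff s i) (allFin n))))) ⟩
    Σ (map (λ i → Σ (map (linearCoeff s i) (allFin n)) * var i m) (allFin n)) ∎
    where
    row = λ i → map (λ j → spins s i j · XA A i j) (allFin n)
    terms = concatMap row (allFin n)
    reassoc : ∀ x a v → half * (x * (a * v)) ≈ half * (x * a) * v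
    reassoc x a v = trans (*-congˡ (sym (*-assoc x a v))) (sym (*-assoc half (x * a) v))

  coeffAllOnes-gaussian≈weightedSum : coeffAllOnes (gaussianCoshExpectation (XA A)) ≈ weightedSum
  coeffAllOnes-gaussian≈weightedSum = begin
    Σₛ (map (λ s → expₛ (quadForm (XA A) s)) (allSigns n)) (replicate n 1)
      ≡⟨ Σₛ-apply (map (λ s → expₛ (quadForm (XA A) s)) (allSigns n)) (replicate n 1) ⟩
    Σ (map (λ f → f (replicate n 1)) (map (λ s → expₛ (quadForm (XA A) s)) (allSigns n)))
      ≡⟨ Σ.map-map (λ f → f (replicate n 1)) (λ s → expₛ (quadForm (XA A) s)) (allSigns n) ⟩
    Σ (map (λ s → coeffAllOnes (expₛ (quadForm (XA A) s))) (allSigns n))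
      ≈⟨ Σ.map-cong (allSigns n) (λ s → coeffAllOnes-expₛ-linear (quadForm-linear s)) ⟩
    Σ (map (λ s → Π (map (λ i → Σ (map (linearCoeff s i) (allFin n))) (allFin n))) (allSigns n))
      ≈⟨ Σ.map-cong (allSigns n) (λ s → Π-Σ-distrib (allFin n) n (linearCoeff s)) ⟩
    Σ (map (λ s → Σ (map (term s) V)) (allSigns n))
      ≈⟨ Σ.exchange term (allSigns n) V ⟩
    Σ (map (λ σ → Σ (map (λ s → term s σ) (allSigns n))) V)
      ≈⟨ Σ.map-cong V separate ⟩
    Σ (map (λ σ → signWeight σ * entryProduct σ) V)
      ≡⟨ ≡.cong (λ t → Σ (map (λ σ → signWeight σ * entryProduct σ) t)) (allVecs≡vecsOver n n) ⟨
    weightedSum ∎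
    where
    V = vecsOver (allFin n) n
    term : Vec Bool n → Vec (Fin n) n → Carrier
    term s σ = Π (map (λ i → linearCoeff s i (lookup σ i)) (allFin n))
    separate : ∀ σ → Σ (map (λ s → term s σ) (allSigns n)) ≈ signWeight σ * entryProduct σ
    separate σ = begin
      Σ (map (λ s → term s σ) (allSigns n))
        ≈⟨ Σ.map-cong (allSigns n) (λ s → trans (Π.map-cong (allFin n) (λ i → sym (*-assoc _ _ _)))
             (Π.map-∙ (λ i → half * spins s i (lookup σ i)) (λ i → A i (lookup σ i)) (allFin n))) ⟩
      Σ (map (λ s → Π (map (λ i → half * spins s i (lookup σ i)) (allFin n)) * entryProduct σ) (allSigns n))
        ≈⟨ *-distribʳ-Σ (entryProduct σ) _ (allSigns n) ⟨
      signWeight σ * entryProduct σ ∎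

corollary3 : ∀ {c ℓ} (F : CharZeroField c ℓ) (n : ℕ) (A : Field.Matrix F n) →
    ¬ Field._≈_ F (Field.det F A) (Field.0# F) →
    Field._≈_ F (Field.perm F A)
      (Field.coeffAllOnes F (Field.gaussianCoshExpectation F (Field.XA F A)))
corollary3 F n A _ = trans perm≈weightedSum (sym coeffAllOnes-gaussian≈weightedSum)
  where
  open Field F using (trans; sym)
  open Gaussian F A
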